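{- Let $t,v,w\in\mathbb Q^n$ with $v\neq 0$. For every $\varepsilon>0$ there are rational numbers $\delta,\tau\in(0,\varepsilon)$ such that $\mathrm{den}(t+\delta v)=\mathrm{den}(t+\delta v+\tau w)$.
   Context: For $u=(u_1,\dots,u_n)\in\mathbb Q^n$, $\mathrm{den}(u)$ is the least common multiple of the denominators (in lowest terms) of $u_1,\dots,u_n$. -}

module Defs where

open import Data.Nat using (ℕ; zero; suc)
open import Data.Nat.LCM using (lcm)
open import Data.Fin using (Fin; zero; suc)
open import Data.Rational using (ℚ; ↧ₙ_; _+_; _*_)

Vecℚ : ℕ → Set
Vecℚ n = Fin n → ℚ

den : ∀ {n} → Vecℚ n → ℕ
den {zero}  u = 1
den {suc n} u = lcm (↧ₙ u zero) (den {n} (λ i → u (suc i)))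

_+ᵥ_ : ∀ {n} → Vecℚ n → Vecℚ n → Vecℚ n
(u +ᵥ w) i = u i + w i

_·ᵥ_ : ∀ {n} → ℚ → Vecℚ n → Vecℚ n
(c ·ᵥ u) i = c * u i

infixl 6 _+ᵥ_
infixl 7 _·ᵥ_

-- If D² divides the denominator of one coordinate of u, then D ∣ den u, so
-- den (u + τ w) ∣ den u; and that coordinate of u + τ w still has a denominator
-- divisible by D, because ↧ (a + b) is a multiple of ↧ a / ↧ b. For u = t + δ v it suffices to pick v_j = p/q ≠ 0 and
-- δ = 1/(|p| N) with N a multiple of ↧ (t_j) D², since then ↧ (δ v_j) = q N.

module Submission where

open import Algebra.Properties.Group using (//-rightDividesʳ)
open import Data.Fin using (Fin; zero; suc)
open import Data.Fin.Properties using (¬∀⟶∃¬)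
open import Data.Integer as ℤ using (ℤ; +_)
import Data.Integer.Properties as ℤP
open import Data.Integer.Solver using (module +-*-Solver)
import Data.Nat.Solver
open import Data.Nat as ℕ using (ℕ; zero; suc; NonZero)
import Data.Nat.Coprimality as Coprimality
open import Data.Nat.Divisibility
open import Data.Nat.GCD using (gcd; gcd[m,n]∣m; gcd-greatest)
open import Data.Nat.LCM using (lcm; m∣lcm[m,n]; n∣lcm[m,n]; lcm-least)
import Data.Nat.Properties as ℕP
open import Data.Product using (Σ; _,_; _×_)
open import Data.Rational as ℚ using (ℚ; mkℚ; 0ℚ; *<*; _<_; ↥_; ↧_; ↧ₙ_; _/_; toℚᵘ)
import Data.Rational.Properties as ℚP
open import Data.Rational.Unnormalised as ℚᵘ using (mkℚᵘ; *≡*)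
import Data.Rational.Unnormalised.Properties as ℚᵘP
open import Data.Vec.Functional using (tail)
open import Function using (_∘_)
open import Relation.Binary.PropositionalEquality
open import Relation.Nullary using (¬_)
open import Defs

1/suc : ℕ → ℚ
1/suc k = mkℚ (+ 1) k (Coprimality.1-coprimeTo (suc k))

1/suc-pos : ∀ k → 0ℚ < 1/suc k
1/suc-pos k = *<* (ℤ.+<+ (ℕ.s≤s ℕ.z≤n))

1/suc-< : ∀ {ε} k → 0ℚ < ε → ↧ₙ ε ℕ.≤ k → 1/suc k < ε
1/suc-< {mkℚ (+ 0) _ _}      _ (*<* (ℤ.+<+ ())) _
1/suc-< {mkℚ ℤ.-[1+ _ ] _ _} _ (*<* ())         _
1/suc-< {mkℚ (+ suc a) b _} k _ b<k = *<* (ℤ.+<+ (ℕ.s≤s (begin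
  suc (b ℕ.+ 0)        ≡⟨ cong suc (ℕP.+-identityʳ b) ⟩
  suc b                ≤⟨ b<k ⟩
  k                    ≤⟨ ℕP.m≤m+n k (a ℕ.* suc k) ⟩
  k ℕ.+ a ℕ.* suc k    ∎)))
  where open ℕP.≤-Reasoning

↧ₙ[i/n]∣n : ∀ i n .{{_ : NonZero n}} → ↧ₙ (i / n) ∣ n
↧ₙ[i/n]∣n i n = divides (gcd ℤ.∣ i ∣ n) (ℤP.+-injective (begin
  + n                                  ≡⟨ ℚP.↧-/ i n ⟨
  ↧ (i / n) ℤ.* + gcd ℤ.∣ i ∣ n          ≡⟨ ℤP.pos-* (↧ₙ (i / n)) (gcd ℤ.∣ i ∣ n) ⟨
  + (↧ₙ (i / n) ℕ.* gcd ℤ.∣ i ∣ n)       ≡⟨ cong +_ (ℕP.*-comm (↧ₙ (i / n)) (gcd ℤ.∣ i ∣ n)) ⟩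
  + (gcd ℤ.∣ i ∣ n ℕ.* ↧ₙ (i / n))       ∎))
  where open ≡-Reasoning

↧ₙ∣suc⇒≃ : ∀ q m → ↧ₙ q ∣ suc m → Σ ℤ (λ k → toℚᵘ q ℚᵘ.≃ mkℚᵘ k m)
↧ₙ∣suc⇒≃ q@record{} m (divides c eq) = ↥ q ℤ.* + c , *≡* (begin
  ↥ q ℤ.* + suc m                 ≡⟨ cong (λ d → ↥ q ℤ.* + d) eq ⟩
  ↥ q ℤ.* + (c ℕ.* ↧ₙ q)          ≡⟨ cong (↥ q ℤ.*_) (ℤP.pos-* c (↧ₙ q)) ⟩
  ↥ q ℤ.* (+ c ℤ.* ↧ q)          ≡⟨ ℤP.*-assoc (↥ q) (+ c) (↧ q) ⟨
  ↥ q ℤ.* + c ℤ.* ↧ q            ∎)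
  where open ≡-Reasoning

≃⇒↧ₙ∣suc : ∀ q k m → toℚᵘ q ℚᵘ.≃ mkℚᵘ k m → ↧ₙ q ∣ suc m
≃⇒↧ₙ∣suc q k m q≃k/m = subst (λ r → ↧ₙ r ∣ suc m) k/m≡q (↧ₙ[i/n]∣n k (suc m))
  where
  k/m≡q : k / suc m ≡ q
  k/m≡q = ℚP.toℚᵘ-injective (ℚᵘP.≃-trans (ℚP.toℚᵘ-fromℚᵘ (mkℚᵘ k m)) (ℚᵘP.≃-sym q≃k/m))

+-common-denominator : ∀ a b M → (a ℤ.* + M ℤ.+ b ℤ.* + M) ℤ.* + M ≡ (a ℤ.+ b) ℤ.* + (M ℕ.* M)
+-common-denominator a b M = begin
  (a ℤ.* + M ℤ.+ b ℤ.* + M) ℤ.* + M   ≡⟨ solve 3 (λ a b M → (a :* M :+ b :* M) :* M := (a :+ b) :* (M :* M)) refl a b (+ M) ⟩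
  (a ℤ.+ b) ℤ.* (+ M ℤ.* + M)         ≡⟨ cong ((a ℤ.+ b) ℤ.*_) (ℤP.pos-* M M) ⟨
  (a ℤ.+ b) ℤ.* + (M ℕ.* M)           ∎
  where open +-*-Solver; open ≡-Reasoning

↧ₙ-+-∣ : ∀ x y {m} → ↧ₙ x ∣ m → ↧ₙ y ∣ m → ↧ₙ (x ℚ.+ y) ∣ m
↧ₙ-+-∣ x y {zero}  _     _     = ↧ₙ (x ℚ.+ y) ∣0
↧ₙ-+-∣ x y {suc m} x∣sm y∣sm with ↧ₙ∣suc⇒≃ x m x∣sm | ↧ₙ∣suc⇒≃ y m y∣sm
... | a , x≃a/m | b , y≃b/m = ≃⇒↧ₙ∣suc (x ℚ.+ y) (a ℤ.+ b) m (begin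
  toℚᵘ (x ℚ.+ y)                   ≈⟨ ℚP.toℚᵘ-homo-+ x y ⟩
  toℚᵘ x ℚᵘ.+ toℚᵘ y               ≈⟨ ℚᵘP.+-cong x≃a/m y≃b/m ⟩
  mkℚᵘ a m ℚᵘ.+ mkℚᵘ b m           ≈⟨ *≡* (+-common-denominator a b (suc m)) ⟩
  mkℚᵘ (a ℤ.+ b) m                 ∎)
  where open ℚᵘP.≃-Reasoning

↧ₙ-neg : ∀ q → ↧ₙ (ℚ.- q) ≡ ↧ₙ q
↧ₙ-neg q = ℤP.+-injective (ℚP.↧-neg q)

↧ₙ-+-∣⁻¹ : ∀ x y {m} → ↧ₙ (x ℚ.+ y) ∣ m → ↧ₙ y ∣ m → ↧ₙ x ∣ m
↧ₙ-+-∣⁻¹ x y {m} x+y∣m y∣m = subst (λ r → ↧ₙ r ∣ m) (//-rightDividesʳ ℚP.+-0-group y x)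
  (↧ₙ-+-∣ (x ℚ.+ y) (ℚ.- y) x+y∣m (subst (_∣ m) (sym (↧ₙ-neg y)) y∣m))

*∣↧ₙ⇒∣↧ₙ-+ : ∀ x y {m} → ↧ₙ y ℕ.* m ∣ ↧ₙ x → m ∣ ↧ₙ (x ℚ.+ y)
*∣↧ₙ⇒∣↧ₙ-+ x y@record{} {m} y*m∣x = *-cancelˡ-∣ (↧ₙ y) (∣-trans y*m∣x x∣y*[x+y])
  where
  x∣y*[x+y] : ↧ₙ x ∣ ↧ₙ y ℕ.* ↧ₙ (x ℚ.+ y)
  x∣y*[x+y] = ↧ₙ-+-∣⁻¹ x y (n∣m*n (↧ₙ y)) (m∣m*n (↧ₙ (x ℚ.+ y)))

↧ₙ-1/suc-* : ∀ k x M → ℤ.∣ ↥ x ∣ ℕ.* M ≡ suc k → ↧ₙ (1/suc k ℚ.* x) ≡ ↧ₙ x ℕ.* M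
↧ₙ-1/suc-* k x@record{} M pM≡1+k = ℕP.*-cancelʳ-≡ (↧ₙ z) (↧ₙ x ℕ.* M) p (begin
  ↧ₙ z ℕ.* p                                  ≡⟨ cong (↧ₙ z ℕ.*_) gcd≡p ⟨
  ↧ₙ z ℕ.* gcd ℤ.∣ + 1 ℤ.* ↥ x ∣ (suc k ℕ.* ↧ₙ x) ≡⟨ ℤP.+-injective (trans (ℤP.pos-* (↧ₙ z) _) (ℚP.↧-/ (+ 1 ℤ.* ↥ x) (suc k ℕ.* ↧ₙ x))) ⟩
  suc k ℕ.* ↧ₙ x                              ≡⟨ cong (ℕ._* ↧ₙ x) pM≡1+k ⟨
  p ℕ.* M ℕ.* ↧ₙ x                            ≡⟨ solve 3 (λ p M d → p :* M :* d := d :* M :* p) refl p M (↧ₙ x) ⟩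
  ↧ₙ x ℕ.* M ℕ.* p                            ∎)
  where
  open ≡-Reasoning
  open Data.Nat.Solver.+-*-Solver
  z = 1/suc k ℚ.* x
  p = ℤ.∣ ↥ x ∣
  instance p≢0 = ℕP.m*n≢0⇒m≢0 p {{ℕ.≢-nonZero (λ pM≡0 → ℕP.0≢1+n (trans (sym pM≡0) pM≡1+k))}}
  p∣[1+k]*d : p ∣ suc k ℕ.* ↧ₙ x
  p∣[1+k]*d = ∣-trans (subst (p ∣_) pM≡1+k (m∣m*n M)) (m∣m*n (↧ₙ x))
  gcd≡p : gcd ℤ.∣ + 1 ℤ.* ↥ x ∣ (suc k ℕ.* ↧ₙ x) ≡ p
  gcd≡p rewrite ℤP.*-identityˡ (↥ x) = ∣-antisym (gcd[m,n]∣m p _) (gcd-greatest ∣-refl p∣[1+k]*d)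

lcm≢0 : ∀ m n .{{_ : NonZero m}} .{{_ : NonZero n}} → NonZero (lcm m n)
lcm≢0 m n = ℕ.≢-nonZero λ lcm≡0 →
  ℕ.≢-nonZero⁻¹ (m ℕ.* n) {{ℕP.m*n≢0 m n}} (0∣⇒≡0 (subst (_∣ m ℕ.* n) lcm≡0 (lcm-least (m∣m*n {m} n) (n∣m*n m))))

den≢0 : ∀ {n} (u : Vecℚ n) → NonZero (den u)
den≢0 {zero}  u = _
den≢0 {suc n} u = lcm≢0 (↧ₙ (u zero)) (den (tail u)) {{_}} {{den≢0 (tail u)}}

↧ₙ∣den : ∀ {n} (u : Vecℚ n) i → ↧ₙ (u i) ∣ den u
↧ₙ∣den u zero    = m∣lcm[m,n] (↧ₙ (u zero)) (den (tail u))
↧ₙ∣den u (suc i) = ∣-trans (↧ₙ∣den (tail u) i) (n∣lcm[m,n] (↧ₙ (u zero)) (den (tail u)))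

den-least : ∀ {n} (u : Vecℚ n) {m} → (∀ i → ↧ₙ (u i) ∣ m) → den u ∣ m
den-least {zero}  u {m} _  = 1∣ m
den-least {suc n} u     ∣m = lcm-least (∣m zero) (den-least (tail u) (∣m ∘ suc))

den-+ᵥ-stable : ∀ {n} (u z : Vecℚ n) j → den z ℕ.* den z ∣ ↧ₙ (u j) → den (u +ᵥ z) ≡ den u
den-+ᵥ-stable u z j z²∣uⱼ = ∣-antisym
  (den-least (u +ᵥ z) λ i → ↧ₙ-+-∣ (u i) (z i) (↧ₙ∣den u i) (∣-trans (↧ₙ∣den z i) z∣u))
  (den-least u λ i → ↧ₙ-+-∣⁻¹ (u i) (z i) (↧ₙ∣den (u +ᵥ z) i) (∣-trans (↧ₙ∣den z i) z∣u+z))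
  where
  z∣u : den z ∣ den u
  z∣u = ∣-trans (m∣m*n (den z)) (∣-trans z²∣uⱼ (↧ₙ∣den u j))
  z∣u+z : den z ∣ den (u +ᵥ z)
  z∣u+z = ∣-trans (*∣↧ₙ⇒∣↧ₙ-+ (u j) (z j) (∣-trans (*-pres-∣ (↧ₙ∣den z j) ∣-refl) z²∣uⱼ))
                  (↧ₙ∣den (u +ᵥ z) j)

small-δ-with-M∣↧ₙ[a+δx] : ∀ a x {{x≢0 : ℚ.NonZero x}} M .{{_ : NonZero M}} {ε} → 0ℚ < ε →
  Σ ℚ (λ δ → (0ℚ < δ × δ < ε) × M ∣ ↧ₙ (a ℚ.+ δ ℚ.* x))
small-δ-with-M∣↧ₙ[a+δx] a@record{} x@record{} {{x≢0}} M {ε} ε>0 = δ , (1/suc-pos k , 1/suc-< k ε>0 ε≤k) , M∣a+δx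
  where
  N = ↧ₙ a ℕ.* M ℕ.* suc (↧ₙ ε)
  P = ℤ.∣ ↥ x ∣ ℕ.* N
  instance
    ∣↥x∣≢0 : NonZero ℤ.∣ ↥ x ∣
    ∣↥x∣≢0 = x≢0
    N≢0 = ℕP.m*n≢0 (↧ₙ a ℕ.* M) (suc (↧ₙ ε)) {{ℕP.m*n≢0 (↧ₙ a) M}}
    P≢0 = ℕP.m*n≢0 ℤ.∣ ↥ x ∣ N
  k = ℕ.pred P
  δ = 1/suc k
  ε≤k : ↧ₙ ε ℕ.≤ k
  ε≤k = ℕP.<⇒≤pred (begin-strict
    ↧ₙ ε         <⟨ ℕP.n<1+n (↧ₙ ε) ⟩
    suc (↧ₙ ε)   ≤⟨ ℕP.m≤n*m (suc (↧ₙ ε)) (↧ₙ a ℕ.* M) {{ℕP.m*n≢0 (↧ₙ a) M}} ⟩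
    N            ≤⟨ ℕP.m≤n*m N ℤ.∣ ↥ x ∣ ⟩
    P            ∎)
    where open ℕP.≤-Reasoning
  aM∣δx : ↧ₙ a ℕ.* M ∣ ↧ₙ (δ ℚ.* x)
  aM∣δx = subst (↧ₙ a ℕ.* M ∣_) (sym (↧ₙ-1/suc-* k x N (sym (ℕP.suc-pred P))))
                (∣-trans (m∣m*n (suc (↧ₙ ε))) (n∣m*n (↧ₙ x)))
  M∣a+δx : M ∣ ↧ₙ (a ℚ.+ δ ℚ.* x)
  M∣a+δx = subst (λ r → M ∣ ↧ₙ r) (ℚP.+-comm (δ ℚ.* x) a) (*∣↧ₙ⇒∣↧ₙ-+ (δ ℚ.* x) a aM∣δx)

small-δ-with-den-+ᵥ-stable : ∀ {n} (t v z : Vecℚ n) j → v j ≢ 0ℚ → ∀ {ε} → 0ℚ < ε →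
  Σ ℚ (λ δ → (0ℚ < δ × δ < ε) × den (t +ᵥ δ ·ᵥ v +ᵥ z) ≡ den (t +ᵥ δ ·ᵥ v))
small-δ-with-den-+ᵥ-stable t v z j vⱼ≢0 ε>0
  with δ , δ-bounds , z²∣tⱼ+δvⱼ ← small-δ-with-M∣↧ₙ[a+δx] (t j) (v j) {{ℚ.≢-nonZero vⱼ≢0}}
                                    (den z ℕ.* den z) {{ℕP.m*n≢0 _ _ {{den≢0 z}} {{den≢0 z}}}} ε>0
  = δ , δ-bounds , den-+ᵥ-stable (t +ᵥ δ ·ᵥ v) z j z²∣tⱼ+δvⱼ

lemma4p3 : ∀ {n : ℕ} (t v w : Vecℚ n) → ¬ (∀ (i : Fin n) → v i ≡ 0ℚ) →
    ∀ (ε : ℚ) → 0ℚ < ε →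
    Σ ℚ (λ δ → Σ ℚ (λ τ → (0ℚ < δ × δ < ε) × (0ℚ < τ × τ < ε) ×
    den (t +ᵥ δ ·ᵥ v) ≡ den (t +ᵥ δ ·ᵥ v +ᵥ τ ·ᵥ w)))
lemma4p3 {n} t v w v≢0 ε ε>0
  with j , vⱼ≢0 ← ¬∀⟶∃¬ n (λ i → v i ≡ 0ℚ) (λ i → v i ℚP.≟ 0ℚ) v≢0
  with δ , δ-bounds , stable ← small-δ-with-den-+ᵥ-stable t v (1/suc (↧ₙ ε) ·ᵥ w) j vⱼ≢0 ε>0
  = δ , 1/suc (↧ₙ ε) , δ-bounds , (1/suc-pos (↧ₙ ε) , 1/suc-< (↧ₙ ε) ε>0 ℕP.≤-refl) , sym stable
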